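{- The map $m\mapsto(\sigma(m),\mu_B(m)')$ is a bijection between the set of all monomials in $\mathbf{Q}[x_1,\dots,x_n]$ and the set of all pairs $(\sigma,\tilde\mu)$ with $\sigma\in B_n$ and $\tilde\mu$ a partition with at most $n$ parts.
   Context: $B_n$ is the group of signed permutations of $[-n,n]\setminus\{0\}$. For $\sigma\in B_n$: $d_i(\sigma)=|\{j\ge i: j\le n-1,\ \sigma(j)>\sigma(j+1)\}|$, $\varepsilon_i(\sigma)=1$ if $\sigma(i)<0$ else $0$, $f_i(\sigma)=2d_i(\sigma)+\varepsilon_i(\sigma)$. For a monomial $m=\prod x_i^{p_i}$: its signed index permutation $\sigma(m)$ is the unique $\sigma\in B_n$ with $p_{|\sigma(i)|}\ge p_{|\sigma(i+1)|}$; $\sigma(i)<\sigma(i+1)$ whenever $p_{|\sigma(i)|}=p_{|\sigma(i+1)|}$; and $\sigma(i)>0$ iff $p_{|\sigma(i)|}$ is even. With $\sigma=\sigma(m)$, $\mu_B(m)$ is the partition conjugate to $((p_{|\sigma(i)|}-f_i(\sigma))/2)_{i=1}^n$, so $\mu_B(m)'$ is this weakly decreasing sequence of nonnegative integers. -}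

module Defs where

open import Data.Nat using (ℕ; zero; suc; _+_; _*_; _≤_; _<_; _≤?_; _<?_)
open import Data.Nat.Divisibility using (_∣_)
open import Data.Integer as ℤ using (ℤ; +_; -[1+_])
import Data.Integer.Properties as ℤP
open import Data.Fin using (Fin; toℕ; fromℕ<)
open import Data.Bool using (Bool; true; false)
open import Data.List using (List; length; filter; upTo)
open import Data.Product using (Σ; _×_; _,_; proj₁; proj₂)
open import Relation.Binary.PropositionalEquality using (_≡_)
open import Relation.Nullary using (yes; no)
open import Relation.Nullary.Decidable using (_×-dec_)
open import Function using (_⇔_)
open import Function.Definitions using (Injective)

-- A monomial x_1^{p_1} ... x_n^{p_n} in Q[x_1..x_n] is identified with its
-- exponent vector p : Fin n → ℕ (index i : Fin n stands for the variable x_{i+1}).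
Monomial : ℕ → Set
Monomial n = Fin n → ℕ

-- We encode σ(i+1) by a pair (a , s) : Fin n × Bool meaning
--   σ(i+1) = a+1   if s = false,
--   σ(i+1) = -(a+1) if s = true,
-- and require that i ↦ |σ(i+1)| (i.e. i ↦ a) is injective (hence a permutation).
SignedPerm : ℕ → Set
SignedPerm n = Σ (Fin n → Fin n × Bool) (λ σ → Injective _≡_ _≡_ (λ i → proj₁ (σ i)))

absIx : ∀ {n} → SignedPerm n → Fin n → Fin n
absIx (σ , _) i = proj₁ (σ i)

negBit : ∀ {n} → SignedPerm n → Fin n → Bool
negBit (σ , _) i = proj₂ (σ i)

val : ∀ {n} → SignedPerm n → Fin n → ℤ
val σ i with negBit σ i
... | false = + suc (toℕ (absIx σ i))
... | true  = -[1+ toℕ (absIx σ i) ]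

-- σ evaluated at the 0-based position k (junk value 0 outside range; never used there)
valℕ : ∀ {n} → SignedPerm n → ℕ → ℤ
valℕ {n} σ k with k <? n
... | yes k<n = val σ (fromℕ< k<n)
... | no _    = + 0

des : ∀ {n} → SignedPerm n → Fin n → ℕ
des {n} σ i =
  length (filter (λ j → ((toℕ i ≤? j) ×-dec (suc j <? n)) ×-dec (valℕ σ (suc j) ℤ.<? valℕ σ j))
                 (upTo n))

eps : ∀ {n} → SignedPerm n → Fin n → ℕ
eps σ i with negBit σ i
... | true  = 1
... | false = 0

fB : ∀ {n} → SignedPerm n → Fin n → ℕ
fB σ i = 2 * des σ i + eps σ i

-- weakly decreasing sequences of length n = partitions with at most n parts
-- (padded with zeros)
WeaklyDecreasing : ∀ {n} → (Fin n → ℕ) → Set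
WeaklyDecreasing {n} μ = ∀ (i j : Fin n) → toℕ i ≤ toℕ j → μ j ≤ μ i

Partition : ℕ → Set
Partition n = Σ (Fin n → ℕ) WeaklyDecreasing

-- σ is the signed index permutation σ(m) of the monomial m (the defining
-- properties from the paper, written with 0-based positions)
IsSignedIndexPerm : ∀ {n} → Monomial n → SignedPerm n → Set
IsSignedIndexPerm {n} p σ =
  (∀ (i j : Fin n) → toℕ j ≡ suc (toℕ i) →
     (p (absIx σ j) ≤ p (absIx σ i)) ×
     (p (absIx σ i) ≡ p (absIx σ j) → val σ i ℤ.< val σ j))
  × (∀ (i : Fin n) → (val σ i ℤ.> + 0) ⇔ (2 ∣ p (absIx σ i)))

-- (σ , μ̃) = (σ(m) , μ_B(m)'): σ = σ(m) and  μ̃_i = (p_{|σ(i)|} - f_i(σ)) / 2,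
-- stated as  2 μ̃_i + f_i(σ) = p_{|σ(i)|}  (μ̃_i a natural number).
Rel : ∀ {n} → Monomial n → SignedPerm n → (Fin n → ℕ) → Set
Rel p σ μ = IsSignedIndexPerm p σ × (∀ i → 2 * μ i + fB σ i ≡ p (absIx σ i))

_≈ₘ_ : ∀ {n} → Monomial n → Monomial n → Set
p ≈ₘ q = ∀ i → p i ≡ q i

_≈ₛ_ : ∀ {n} → SignedPerm n → SignedPerm n → Set
σ ≈ₛ τ = ∀ i → proj₁ σ i ≡ proj₁ τ i

_≈ₚ_ : ∀ {n} → Partition n → Partition n → Set
μ ≈ₚ ν = ∀ i → proj₁ μ i ≡ proj₁ ν i

{-# OPTIONS --safe #-}
module Submission where

-- σ(m) lists the variables by decreasing exponent, ties broken by increasing signed index,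
-- the sign recording the parity of the exponent. Such a key is injective, so σ(m) is obtained
-- by sorting via ranks, and it is unique because a strictly increasing self-map of Fin n is the
-- identity. Write p_{|σ(i)|} = 2 h_i + ε_i. Along adjacent positions
-- d_i = [σ(i) > σ(i+1)] + d_{i+1} and h_i ≥ [σ(i) > σ(i+1)] + h_{i+1}, the latter because equal
-- exponents force an ascent and a descent σ(i) > σ(i+1) forces ε_i ≤ ε_{i+1}. Downward
-- induction from d_n = 0 gives d_i ≤ h_i, and μ_i = h_i - d_i is weakly decreasing, with
-- 2 μ_i + f_i = p_{|σ(i)|}. Conversely, for a partition μ the numbers 2 μ_i + f_i decrease weakly
-- along the positions, strictly at descents, and have parity ε_i, so σ is the signed index
-- permutation of the monomial with these exponents.

open import Defs
open import Data.Nat as ℕ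
  using (ℕ; suc; _+_; _*_; _∸_; _≤_; _<_; _≤?_; _<?_; _%_; _/_; _≡ᵇ_; z≤n; s≤s; s≤s⁻¹)
open import Data.Nat.Properties as ℕ
  using ( ≤-refl; ≤-reflexive; ≤-trans; ≤-antisym; ≤-<-trans; <-≤-trans; <-cmp; <-irrefl; <-asym
        ; <⇒≤; <⇒≢; <⇒≱; ≤∧≢⇒<; 1+n≢n; m≤n⇒m<n∨m≡n; n<1+n; m≤m+n
        ; +-comm; +-assoc; *-comm; *-suc; *-distribˡ-+; +-monoʳ-≤; +-mono-≤; +-mono-≤-<; *-monoʳ-≤
        ; +-cancelʳ-<; +-cancelʳ-≡; *-cancelˡ-<; *-cancelˡ-≡
        ; ∸-monoˡ-≤; m∸n+n≡m; [m+n]∸[m+o]≡n∸o )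
open import Data.Nat.DivMod using (m%n<n; m≡m%n+[m/n]*n; [m+kn]%n≡m%n; m<n⇒m%n≡m; /-monoˡ-≤)
open import Data.Nat.Divisibility using (_∣_; m%n≡0⇒n∣m; n∣m⇒m%n≡0)
open import Data.Integer as ℤ using (ℤ; -[1+_]; +<+)
import Data.Integer.Properties as ℤ
open import Data.Fin as Fin using (Fin; toℕ; fromℕ; fromℕ<; inject₁; punchOut)
open import Data.Fin.Properties
  using (toℕ-injective; toℕ<n; toℕ-fromℕ; toℕ-fromℕ<; fromℕ<-toℕ; toℕ-inject₁; any?; _≟_
        ; punchOut-injective; injective⇒≤)
open import Data.Fin.Induction using (<-weakInduction; >-weakInduction)
open import Data.Fin.Subset using (Subset; _∈_; _⊂_; ∣_∣)
open import Data.Fin.Subset.Properties using (p⊂q⇒∣p∣<∣q∣; ∣⊤∣≡n; ∈⊤)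
open import Data.Vec using (tabulate)
open import Data.Vec.Properties using (lookup∘tabulate; lookup⇒[]=; []=⇒lookup)
open import Data.Bool using (Bool; true; false)
open import Data.List using ([_]; _++_; length; filter; upTo)
open import Data.List.Properties
  using (filter-++; length-++; filter-≐; filter-none; filter-accept; filter-reject; upTo-∷ʳ)
open import Data.List.Relation.Unary.All.Properties using (applyUpTo⁺₁)
open import Data.Product using (Σ; ∃; _×_; _,_; proj₁; proj₂; map₁; map₂; assocʳ′; assocˡ′; uncurry)
open import Data.Product.Relation.Binary.Lex.Strict using (×-strictTotalOrder)
open import Data.Sum using (inj₁; inj₂)
open import Function using (_∘_; _⇔_; mk⇔; Equivalence; Injective)
open import Level using (Level; 0ℓ)
open import Relation.Binary using (Transitive; StrictTotalOrder; tri<; tri≈; tri>)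
import Relation.Binary.Construct.Flip.EqAndOrd as Flip
open import Relation.Binary.PropositionalEquality hiding ([_])
open import Relation.Nullary using (¬_; yes; no; does; contradiction)
open import Relation.Nullary.Decidable using (_×-dec_; dec-true)
open import Relation.Unary using (Pred; Decidable)

private
  variable
    a ℓ : Level
    m n : ℕ

infix 4 _⋖_

_⋖_ : Fin n → Fin n → Set
i ⋖ j = toℕ j ≡ suc (toℕ i)

⋖-irrefl : ∀ {i j : Fin n} → i ⋖ j → i ≢ j
⋖-irrefl i⋖j refl = 1+n≢n (sym i⋖j)

⋖⇒< : ∀ {i j : Fin n} → i ⋖ j → toℕ i < toℕ j
⋖⇒< i⋖j = ≤-reflexive (sym i⋖j)

inject₁⋖suc : ∀ (i : Fin n) → inject₁ i ⋖ Fin.suc i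
inject₁⋖suc i = cong suc (sym (toℕ-inject₁ i))

⋖-induction : (P : Fin n → Set ℓ) → (∀ i → toℕ i ≡ 0 → P i) →
              (∀ {i j} → i ⋖ j → P i → P j) → ∀ i → P i
⋖-induction {n = suc n} P first step =
  <-weakInduction P (first Fin.zero refl) (step ∘ inject₁⋖suc)

⋖-downwardInduction : (P : Fin n → Set ℓ) → (∀ i → suc (toℕ i) ≡ n → P i) →
                      (∀ {i j} → i ⋖ j → P j → P i) → ∀ i → P i
⋖-downwardInduction {n = suc n} P last step =
  >-weakInduction P (last (fromℕ n) (cong suc (toℕ-fromℕ n))) (step ∘ inject₁⋖suc)

⋖-chain : ∀ {A : Set a} {_R_ : A → A → Set ℓ} → Transitive _R_ → {f : Fin n → A} →
          (∀ {i j} → i ⋖ j → f i R f j) → ∀ {i j} → toℕ i < toℕ j → f i R f j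
⋖-chain {_R_ = _R_} R-trans {f} adjacent {i} {j} =
  ⋖-induction (λ j → toℕ i < toℕ j → f i R f j)
    (λ _ j≡0 i<j → contradiction (subst (toℕ i <_) j≡0 i<j) λ ()) step j
  where
  step : ∀ {k l} → k ⋖ l → (toℕ i < toℕ k → f i R f k) → toℕ i < toℕ l → f i R f l
  step {k} k⋖l i<k⇒ i<l with m≤n⇒m<n∨m≡n (s≤s⁻¹ (subst (toℕ i <_) k⋖l i<l))
  ... | inj₁ i<k = R-trans (i<k⇒ i<k) (adjacent k⋖l)
  ... | inj₂ i≡k = subst (λ x → f x R _) (sym (toℕ-injective i≡k)) (adjacent k⋖l)

⋖-weaklyDecreasing : {μ : Fin n → ℕ} → (∀ {i j} → i ⋖ j → μ j ≤ μ i) → WeaklyDecreasing μ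
⋖-weaklyDecreasing {μ = μ} adjacent i j i≤j with m≤n⇒m<n∨m≡n i≤j
... | inj₁ i<j = ⋖-chain {_R_ = λ x y → y ≤ x} (λ x≥y y≥z → ≤-trans y≥z x≥y) adjacent i<j
... | inj₂ i≡j = ≤-reflexive (cong μ (sym (toℕ-injective i≡j)))

injective⇒surjective : {f : Fin n → Fin n} → Injective _≡_ _≡_ f → ∀ b → ∃ λ i → f i ≡ b
injective⇒surjective {n = suc n} {f} f-injective b with any? (λ i → f i ≟ b)
... | yes hit = hit
... | no miss = contradiction (injective⇒≤ punchOut∘f-injective) ℕ.1+n≰n
  where
  b≢f : ∀ i → b ≢ f i
  b≢f i b≡fi = miss (i , sym b≡fi)
  punchOut∘f-injective : Injective _≡_ _≡_ (λ i → punchOut (b≢f i))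
  punchOut∘f-injective = f-injective ∘ punchOut-injective (b≢f _) (b≢f _)

StrictlyIncreasing : (Fin m → Fin n) → Set
StrictlyIncreasing f = ∀ {i j} → toℕ i < toℕ j → toℕ (f i) < toℕ (f j)

strictlyIncreasing⇒≥ : {f : Fin m → Fin n} → StrictlyIncreasing f → ∀ i → toℕ i ≤ toℕ (f i)
strictlyIncreasing⇒≥ {f = f} f↑ =
  ⋖-induction (λ i → toℕ i ≤ toℕ (f i)) (λ i i≡0 → subst (_≤ _) (sym i≡0) z≤n)
    λ {i} {j} i⋖j i≤fi → subst (_≤ toℕ (f j)) (sym i⋖j) (≤-<-trans i≤fi (f↑ (⋖⇒< i⋖j)))

strictlyIncreasing⇒injective : {f : Fin m → Fin n} → StrictlyIncreasing f → Injective _≡_ _≡_ f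
strictlyIncreasing⇒injective f↑ {i} {j} fi≡fj with <-cmp (toℕ i) (toℕ j)
... | tri< i<j _ _ = contradiction (cong toℕ fi≡fj) (<⇒≢ (f↑ i<j))
... | tri≈ _ i≡j _ = toℕ-injective i≡j
... | tri> _ _ j<i = contradiction (cong toℕ (sym fi≡fj)) (<⇒≢ (f↑ j<i))

-- The inverse g is strictly increasing as well, so f i ≤ g (f i) = i.
strictlyIncreasing⇒≡id : {f : Fin n → Fin n} → StrictlyIncreasing f → ∀ i → f i ≡ i
strictlyIncreasing⇒≡id {n = n} {f} f↑ i = toℕ-injective (≤-antisym fi≤i (strictlyIncreasing⇒≥ f↑ i))
  where
  f-injective : Injective _≡_ _≡_ f
  f-injective = strictlyIncreasing⇒injective f↑
  g : Fin n → Fin n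
  g = proj₁ ∘ injective⇒surjective f-injective
  f∘g≡id : ∀ i → f (g i) ≡ i
  f∘g≡id = proj₂ ∘ injective⇒surjective f-injective
  g↑ : StrictlyIncreasing g
  g↑ {i} {j} i<j with <-cmp (toℕ (g i)) (toℕ (g j))
  ... | tri< gi<gj _ _ = gi<gj
  ... | tri≈ _ gi≡gj _ = contradiction
    (trans (sym (f∘g≡id i)) (trans (cong f (toℕ-injective gi≡gj)) (f∘g≡id j))) (<⇒≢ i<j ∘ cong toℕ)
  ... | tri> _ _ gj<gi = contradiction
    (subst₂ _<_ (cong toℕ (f∘g≡id j)) (cong toℕ (f∘g≡id i)) (f↑ gj<gi)) (<-asym i<j)
  fi≤i : toℕ (f i) ≤ toℕ i
  fi≤i = subst (λ x → toℕ (f i) ≤ toℕ x) (f-injective (f∘g≡id (f i)))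
               (strictlyIncreasing⇒≥ g↑ (f i))

-- Sorting a finite family by an injective key

module SortByKey {a ℓ₁ ℓ₂} (O : StrictTotalOrder a ℓ₁ ℓ₂) {n : ℕ}
  (key : Fin n → StrictTotalOrder.Carrier O)
  (key-injective : ∀ {i j} → StrictTotalOrder._≈_ O (key i) (key j) → i ≡ j) where

  open StrictTotalOrder O using (compare; irrefl; module Eq)
    renaming (_<_ to _≺_; _<?_ to _≺?_; trans to ≺-trans)

  Sorted : (Fin n → Fin n) → Set ℓ₂
  Sorted τ = ∀ {i j} → i ⋖ j → key (τ i) ≺ key (τ j)

  keysBelow : Fin n → Subset n
  keysBelow x = tabulate (λ y → does (key y ≺? key x))

  ∈keysBelow⁺ : ∀ {x y} → key y ≺ key x → y ∈ keysBelow x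
  ∈keysBelow⁺ {x} {y} y≺x =
    lookup⇒[]= y _ (trans (lookup∘tabulate _ y) (dec-true (key y ≺? key x) y≺x))

  ∈keysBelow⁻ : ∀ {x y} → y ∈ keysBelow x → key y ≺ key x
  ∈keysBelow⁻ {x} {y} y∈ with key y ≺? key x | trans (sym (lookup∘tabulate _ y)) ([]=⇒lookup y∈)
  ... | yes y≺x | _ = y≺x
  ... | no _    | ()

  ∉keysBelow-self : ∀ x → ¬ x ∈ keysBelow x
  ∉keysBelow-self x = irrefl Eq.refl ∘ ∈keysBelow⁻

  keysBelow-⊂ : ∀ {x y} → key x ≺ key y → keysBelow x ⊂ keysBelow y
  keysBelow-⊂ {x} x≺y =
    (λ z∈ → ∈keysBelow⁺ (≺-trans (∈keysBelow⁻ z∈) x≺y)) , x , ∈keysBelow⁺ x≺y , ∉keysBelow-self x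

  ∣keysBelow∣<n : ∀ x → ∣ keysBelow x ∣ < n
  ∣keysBelow∣<n x =
    subst (∣ keysBelow x ∣ <_) (∣⊤∣≡n n) (p⊂q⇒∣p∣<∣q∣ ((λ _ → ∈⊤) , x , ∈⊤ , ∉keysBelow-self x))

  rank : Fin n → Fin n
  rank x = fromℕ< (∣keysBelow∣<n x)

  rank-monotone : ∀ {x y} → key x ≺ key y → toℕ (rank x) < toℕ (rank y)
  rank-monotone x≺y =
    subst₂ _<_ (sym (toℕ-fromℕ< _)) (sym (toℕ-fromℕ< _)) (p⊂q⇒∣p∣<∣q∣ (keysBelow-⊂ x≺y))

  rank-reflects : ∀ {x y} → toℕ (rank x) < toℕ (rank y) → key x ≺ key y
  rank-reflects {x} {y} rx<ry with compare (key x) (key y)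
  ... | tri< x≺y _ _ = x≺y
  ... | tri≈ _ x≈y _ = contradiction
    (subst (λ z → toℕ (rank z) < toℕ (rank y)) (key-injective x≈y) rx<ry) (<-irrefl refl)
  ... | tri> _ _ y≺x = contradiction (rank-monotone y≺x) (<-asym rx<ry)

  rank-injective : Injective _≡_ _≡_ rank
  rank-injective {x} {y} rx≡ry with compare (key x) (key y)
  ... | tri< x≺y _ _ = contradiction (cong toℕ rx≡ry) (<⇒≢ (rank-monotone x≺y))
  ... | tri≈ _ x≈y _ = key-injective x≈y
  ... | tri> _ _ y≺x = contradiction (cong toℕ (sym rx≡ry)) (<⇒≢ (rank-monotone y≺x))

  sort : Fin n → Fin n
  sort = proj₁ ∘ injective⇒surjective rank-injective

  rank∘sort≡id : ∀ i → rank (sort i) ≡ i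
  rank∘sort≡id = proj₂ ∘ injective⇒surjective rank-injective

  sort-injective : Injective _≡_ _≡_ sort
  sort-injective {i} {j} si≡sj =
    trans (sym (rank∘sort≡id i)) (trans (cong rank si≡sj) (rank∘sort≡id j))

  sort-sorted : Sorted sort
  sort-sorted {i} {j} i⋖j =
    rank-reflects (subst₂ _<_ (cong toℕ (sym (rank∘sort≡id i))) (cong toℕ (sym (rank∘sort≡id j)))
                              (⋖⇒< i⋖j))

  sorted-unique : ∀ {τ} → Sorted τ → ∀ i → τ i ≡ sort i
  sorted-unique {τ} τ-sorted i =
    rank-injective (trans (strictlyIncreasing⇒≡id rank∘τ↑ i) (sym (rank∘sort≡id i)))
    where
    rank∘τ↑ : StrictlyIncreasing (rank ∘ τ)
    rank∘τ↑ = rank-monotone ∘ ⋖-chain {_R_ = _≺_} ≺-trans τ-sorted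

signed : Fin n → Bool → ℤ
signed a false = ℤ.+ suc (toℕ a)
signed a true  = -[1+ toℕ a ]

signed-injective : ∀ {a b : Fin n} {s t} → signed a s ≡ signed b t → a ≡ b
signed-injective {s = false} {false} eq = toℕ-injective (ℕ.suc-injective (ℤ.+-injective eq))
signed-injective {s = true}  {true}  eq = toℕ-injective (ℤ.-[1+-injective eq)

val≡signed : ∀ (σ : SignedPerm n) i → val σ i ≡ signed (absIx σ i) (negBit σ i)
val≡signed σ i with negBit σ i
... | false = refl
... | true  = refl

val-injective : ∀ (σ : SignedPerm n) {i j} → val σ i ≡ val σ j → i ≡ j
val-injective σ {i} {j} eq =
  proj₂ σ (signed-injective (trans (sym (val≡signed σ i)) (trans eq (val≡signed σ j))))

val-cong : ∀ {σ τ : SignedPerm n} → σ ≈ₛ τ → ∀ i → val σ i ≡ val τ i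
val-cong {σ = σ} {τ} σ≈τ i =
  trans (val≡signed σ i) (trans (cong (uncurry signed) (σ≈τ i)) (sym (val≡signed τ i)))

eps≤1 : ∀ (σ : SignedPerm n) i → eps σ i ≤ 1
eps≤1 σ i with negBit σ i
... | false = z≤n
... | true  = s≤s z≤n

eps-cong : ∀ {σ τ : SignedPerm n} → σ ≈ₛ τ → ∀ i → eps σ i ≡ eps τ i
eps-cong {σ = σ} {τ} σ≈τ i with negBit σ i | negBit τ i | cong proj₂ (σ≈τ i)
... | false | false | _ = refl
... | true  | true  | _ = refl

eps-antitone : ∀ (σ : SignedPerm n) {i j} → val σ i ℤ.< val σ j → eps σ j ≤ eps σ i
eps-antitone σ {i} {j} vi<vj with negBit σ i | negBit σ j
... | _     | false = z≤n
... | true  | true  = ≤-refl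
... | false | true  = contradiction vi<vj λ ()

val-positive⇔eps≡0 : ∀ (σ : SignedPerm n) i → val σ i ℤ.> ℤ.+ 0 ⇔ eps σ i ≡ 0
val-positive⇔eps≡0 σ i with negBit σ i
... | false = mk⇔ (λ _ → refl) (λ _ → +<+ (s≤s z≤n))
... | true  = mk⇔ (λ ()) (λ ())

oddBit : ℕ → Bool
oddBit k = k % 2 ≡ᵇ 1

eps≡%2⇔negBit≡oddBit : ∀ (σ : SignedPerm n) i k → eps σ i ≡ k % 2 ⇔ negBit σ i ≡ oddBit k
eps≡%2⇔negBit≡oddBit σ i k with negBit σ i | k % 2 | m%n<n k 2
... | false | 0           | _ = mk⇔ (λ _ → refl) (λ _ → refl)
... | false | 1           | _ = mk⇔ (λ ()) (λ ())
... | true  | 0           | _ = mk⇔ (λ ()) (λ ())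
... | true  | 1           | _ = mk⇔ (λ _ → refl) (λ _ → refl)
... | _     | suc (suc _) | s≤s (s≤s ())

≤1-≡0⇔≡0⇒≡ : ∀ {a b} → a ≤ 1 → b ≤ 1 → (a ≡ 0 → b ≡ 0) → (b ≡ 0 → a ≡ 0) → a ≡ b
≤1-≡0⇔≡0⇒≡ z≤n       z≤n       _         _         = refl
≤1-≡0⇔≡0⇒≡ (s≤s z≤n) (s≤s z≤n) _         _         = refl
≤1-≡0⇔≡0⇒≡ z≤n       (s≤s z≤n) a≡0⇒b≡0 _         = contradiction (a≡0⇒b≡0 refl) λ ()
≤1-≡0⇔≡0⇒≡ (s≤s z≤n) z≤n       _         b≡0⇒a≡0 = contradiction (b≡0⇒a≡0 refl) λ ()

parityCondition⇒eps≡%2 : ∀ (σ : SignedPerm n) i k → (val σ i ℤ.> ℤ.+ 0 ⇔ 2 ∣ k) → eps σ i ≡ k % 2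
parityCondition⇒eps≡%2 σ i k cond = ≤1-≡0⇔≡0⇒≡ (eps≤1 σ i) (s≤s⁻¹ (m%n<n k 2))
  (n∣m⇒m%n≡0 k 2 ∘ Equivalence.to cond ∘ Equivalence.from (val-positive⇔eps≡0 σ i))
  (Equivalence.to (val-positive⇔eps≡0 σ i) ∘ Equivalence.from cond ∘ m%n≡0⇒n∣m k 2)

eps≡%2⇒parityCondition : ∀ (σ : SignedPerm n) i k → eps σ i ≡ k % 2 → (val σ i ℤ.> ℤ.+ 0 ⇔ 2 ∣ k)
eps≡%2⇒parityCondition σ i k eps≡ = mk⇔
  (λ pos → m%n≡0⇒n∣m k 2 (trans (sym eps≡) (Equivalence.to (val-positive⇔eps≡0 σ i) pos)))
  (λ 2∣k → Equivalence.from (val-positive⇔eps≡0 σ i) (trans eps≡ (n∣m⇒m%n≡0 k 2 2∣k)))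

negBit≡oddBit⇔parityCondition : ∀ (σ : SignedPerm n) i k →
                                negBit σ i ≡ oddBit k ⇔ (val σ i ℤ.> ℤ.+ 0 ⇔ 2 ∣ k)
negBit≡oddBit⇔parityCondition σ i k = mk⇔
  (eps≡%2⇒parityCondition σ i k ∘ Equivalence.from (eps≡%2⇔negBit≡oddBit σ i k))
  (Equivalence.to (eps≡%2⇔negBit≡oddBit σ i k) ∘ parityCondition⇒eps≡%2 σ i k)

m≡2*[m/2]+m%2 : ∀ m → m ≡ 2 * (m / 2) + m % 2
m≡2*[m/2]+m%2 m =
  trans (m≡m%n+[m/n]*n m 2) (trans (+-comm (m % 2) _) (cong (_+ m % 2) (*-comm (m / 2) 2)))

[2*q+r]%2≡r : ∀ q {r} → r < 2 → (2 * q + r) % 2 ≡ r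
[2*q+r]%2≡r q {r} r<2 = begin
  (2 * q + r) % 2 ≡⟨ cong (_% 2) (trans (+-comm (2 * q) r) (cong (r +_) (*-comm 2 q))) ⟩
  (r + q * 2) % 2 ≡⟨ [m+kn]%n≡m%n r q 2 ⟩
  r % 2           ≡⟨ m<n⇒m%n≡m r<2 ⟩
  r               ∎
  where open ≡-Reasoning

2*m+a<2*n+b⇒m<n : ∀ {m n a b} → 2 * m + a < 2 * n + b → b ≤ a → m < n
2*m+a<2*n+b⇒m<n {m} {n} {a} lt b≤a =
  *-cancelˡ-< 2 m n (+-cancelʳ-< a (2 * m) (2 * n) (<-≤-trans lt (+-monoʳ-≤ (2 * n) b≤a)))

-- Counting descents

indicator : ∀ {p} {A : Set a} {P : Pred A p} → Decidable P → A → ℕ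
indicator P? x = length (filter P? [ x ])

indicator-cong : ∀ {p q} {A : Set a} {P : Pred A p} {Q : Pred A q} (P? : Decidable P) (Q? : Decidable Q)
                 {x} → (P x → Q x) → (Q x → P x) → indicator P? x ≡ indicator Q? x
indicator-cong P? Q? {x} P⇒Q Q⇒P with P? x
... | yes Px = cong length (sym (filter-accept Q? (P⇒Q Px)))
... | no ¬Px = cong length (sym (filter-reject Q? (¬Px ∘ Q⇒P)))

module CountFrom {p} {D : Pred ℕ p} (D? : Decidable D) where

  from? : ∀ i → Decidable (λ j → i ≤ j × D j)
  from? i j = (i ≤? j) ×-dec D? j

  countFrom : ℕ → ℕ → ℕ
  countFrom i N = length (filter (from? i) (upTo N))

  countFrom-none : ∀ {i N} → (∀ {j} → j < N → i ≤ j → ¬ D j) → countFrom i N ≡ 0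
  countFrom-none {i} {N} none =
    cong length (filter-none (from? i) (applyUpTo⁺₁ _ N λ j<N (i≤j , Dj) → none j<N i≤j Dj))

  countFrom-suc : ∀ i N → countFrom i (suc N) ≡ countFrom i N + indicator (from? i) N
  countFrom-suc i N = begin
    countFrom i (suc N)
      ≡⟨ cong (length ∘ filter (from? i)) (upTo-∷ʳ N) ⟨
    length (filter (from? i) (upTo N ++ [ N ]))
      ≡⟨ cong length (filter-++ (from? i) (upTo N) [ N ]) ⟩
    length (filter (from? i) (upTo N) ++ filter (from? i) [ N ])
      ≡⟨ length-++ (filter (from? i) (upTo N)) ⟩
    countFrom i N + indicator (from? i) N
      ∎
    where open ≡-Reasoning

  countFrom-step : ∀ {i N} → i < N → countFrom i N ≡ indicator D? i + countFrom (suc i) N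
  countFrom-step {i} {suc N} i<1+N with m≤n⇒m<n∨m≡n (s≤s⁻¹ i<1+N)
  ... | inj₂ refl = begin
    countFrom i (suc i)                          ≡⟨ countFrom-suc i i ⟩
    countFrom i i + indicator (from? i) i        ≡⟨ cong₂ _+_
                                                      (countFrom-none {i} {i} λ j<i i≤j _ → <⇒≱ j<i i≤j)
                                                      (indicator-cong (from? i) D? proj₂ (≤-refl ,_)) ⟩
    0 + indicator D? i                           ≡⟨ +-comm 0 (indicator D? i) ⟩
    indicator D? i + 0                           ≡⟨ cong (indicator D? i +_) (countFrom-none {suc i} {suc i}
                                                      λ j<1+i 1+i≤j _ → <⇒≱ j<1+i 1+i≤j) ⟨
    indicator D? i + countFrom (suc i) (suc i)   ∎
    where open ≡-Reasoning
  ... | inj₁ i<N = begin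
    countFrom i (suc N)                                                   ≡⟨ countFrom-suc i N ⟩
    countFrom i N + indicator (from? i) N                                 ≡⟨ cong₂ _+_ (countFrom-step i<N)
      (indicator-cong (from? i) (from? (suc i)) (map₁ λ _ → i<N) (map₁ <⇒≤)) ⟩
    indicator D? i + countFrom (suc i) N + indicator (from? (suc i)) N    ≡⟨ +-assoc (indicator D? i) _ _ ⟩
    indicator D? i + (countFrom (suc i) N + indicator (from? (suc i)) N)  ≡⟨ cong (indicator D? i +_)
                                                                               (countFrom-suc (suc i) N) ⟨
    indicator D? i + countFrom (suc i) (suc N)                            ∎
    where open ≡-Reasoning

open CountFrom using (countFrom; countFrom-none; countFrom-step)

Descent : SignedPerm n → Pred ℕ 0ℓ
Descent {n} σ j = suc j < n × valℕ σ (suc j) ℤ.< valℕ σ j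

descent? : (σ : SignedPerm n) → Decidable (Descent σ)
descent? {n} σ j = (suc j <? n) ×-dec (valℕ σ (suc j) ℤ.<? valℕ σ j)

des≡countFrom : ∀ (σ : SignedPerm n) i → des σ i ≡ countFrom (descent? σ) (toℕ i) n
des≡countFrom {n} σ i = cong length (filter-≐ _ _ (assocʳ′ , assocˡ′) (upTo n))

valℕ-toℕ : ∀ (σ : SignedPerm n) i → valℕ σ (toℕ i) ≡ val σ i
valℕ-toℕ {n} σ i with toℕ i <? n
... | yes i<n = cong (val σ) (fromℕ<-toℕ i i<n)
... | no  i≮n = contradiction (toℕ<n i) i≮n

valℕ-cong : ∀ {σ τ : SignedPerm n} → σ ≈ₛ τ → ∀ k → valℕ σ k ≡ valℕ τ k
valℕ-cong {n} σ≈τ k with k <? n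
... | yes k<n = val-cong σ≈τ (fromℕ< k<n)
... | no  _   = refl

des-cong : ∀ {σ τ : SignedPerm n} → σ ≈ₛ τ → ∀ i → des σ i ≡ des τ i
des-cong {n} σ≈τ i = cong length (filter-≐ _ _
  ((λ {j} → map₂ (subst₂ ℤ._<_ (valℕ-cong σ≈τ (suc j)) (valℕ-cong σ≈τ j))) ,
   (λ {j} → map₂ (subst₂ ℤ._<_ (sym (valℕ-cong σ≈τ (suc j))) (sym (valℕ-cong σ≈τ j)))))
  (upTo n))

fB-cong : ∀ {σ τ : SignedPerm n} → σ ≈ₛ τ → ∀ i → fB σ i ≡ fB τ i
fB-cong {σ = σ} {τ} σ≈τ i =
  cong₂ (λ d e → 2 * d + e) (des-cong {σ = σ} {τ} σ≈τ i) (eps-cong {σ = σ} {τ} σ≈τ i)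

des-last : ∀ (σ : SignedPerm n) i → suc (toℕ i) ≡ n → des σ i ≡ 0
des-last {n} σ i i-last = trans (des≡countFrom σ i) (countFrom-none (descent? σ) {toℕ i} {n}
  λ _ i≤j (1+j<n , _) → <⇒≱ (subst (_ <_) (sym i-last) 1+j<n) (s≤s i≤j))

descent⇔ : ∀ (σ : SignedPerm n) {i j} → i ⋖ j → Descent σ (toℕ i) ⇔ val σ j ℤ.< val σ i
descent⇔ σ {i} {j} i⋖j = mk⇔
  (λ (_ , vj<vi) → subst₂ ℤ._<_ vℕj≡vj vℕi≡vi vj<vi)
  (λ vj<vi → subst (_< _) i⋖j (toℕ<n j) , subst₂ ℤ._<_ (sym vℕj≡vj) (sym vℕi≡vi) vj<vi)
  where
  vℕi≡vi : valℕ σ (toℕ i) ≡ val σ i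
  vℕi≡vi = valℕ-toℕ σ i
  vℕj≡vj : valℕ σ (suc (toℕ i)) ≡ val σ j
  vℕj≡vj = trans (cong (valℕ σ) (sym i⋖j)) (valℕ-toℕ σ j)

des-step : ∀ (σ : SignedPerm n) {i j} → i ⋖ j → des σ i ≡ indicator (descent? σ) (toℕ i) + des σ j
des-step {n} σ {i} {j} i⋖j = begin
  des σ i                                              ≡⟨ des≡countFrom σ i ⟩
  countFrom (descent? σ) (toℕ i) n                     ≡⟨ countFrom-step (descent? σ) (toℕ<n i) ⟩
  δᵢ + countFrom (descent? σ) (suc (toℕ i)) n          ≡⟨ cong (λ k → δᵢ + countFrom (descent? σ) k n) i⋖j ⟨
  δᵢ + countFrom (descent? σ) (toℕ j) n                ≡⟨ cong (δᵢ +_) (des≡countFrom σ j) ⟨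
  δᵢ + des σ j                                         ∎
  where
  open ≡-Reasoning
  δᵢ : ℕ
  δᵢ = indicator (descent? σ) (toℕ i)

des-descent : ∀ (σ : SignedPerm n) {i j} → i ⋖ j → val σ j ℤ.< val σ i → des σ i ≡ suc (des σ j)
des-descent σ i⋖j vj<vi = trans (des-step σ i⋖j)
  (cong (λ xs → length xs + _)
        (filter-accept (descent? σ) (Equivalence.from (descent⇔ σ i⋖j) vj<vi)))

des-ascent : ∀ (σ : SignedPerm n) {i j} → i ⋖ j → val σ i ℤ.< val σ j → des σ i ≡ des σ j
des-ascent σ i⋖j vi<vj = trans (des-step σ i⋖j)
  (cong (λ xs → length xs + _)
        (filter-reject (descent? σ) (ℤ.<-asym vi<vj ∘ Equivalence.to (descent⇔ σ i⋖j))))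

fB-descent : ∀ (σ : SignedPerm n) {i j} → i ⋖ j → val σ j ℤ.< val σ i → fB σ j < fB σ i
fB-descent σ {i} {j} i⋖j vj<vi = begin-strict
  2 * des σ j + eps σ j ≤⟨ +-monoʳ-≤ (2 * des σ j) (eps≤1 σ j) ⟩
  2 * des σ j + 1       ≡⟨ +-comm (2 * des σ j) 1 ⟩
  suc (2 * des σ j)     <⟨ n<1+n _ ⟩
  2 + 2 * des σ j       ≡⟨ *-suc 2 (des σ j) ⟨
  2 * suc (des σ j)     ≡⟨ cong (2 *_) (des-descent σ i⋖j vj<vi) ⟨
  2 * des σ i           ≤⟨ m≤m+n (2 * des σ i) (eps σ i) ⟩
  2 * des σ i + eps σ i ∎
  where open ℕ.≤-Reasoning

fB-ascent : ∀ (σ : SignedPerm n) {i j} → i ⋖ j → val σ i ℤ.< val σ j → fB σ j ≤ fB σ i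
fB-ascent σ {i} {j} i⋖j vi<vj = subst (λ d → fB σ j ≤ 2 * d + eps σ i) (sym (des-ascent σ i⋖j vi<vj))
  (+-monoʳ-≤ (2 * des σ j) (eps-antitone σ vi<vj))

2*q+fB≡2*[q+des]+eps : ∀ (σ : SignedPerm n) i q → 2 * q + fB σ i ≡ 2 * (q + des σ i) + eps σ i
2*q+fB≡2*[q+des]+eps σ i q = trans (sym (+-assoc (2 * q) (2 * des σ i) (eps σ i)))
                                   (cong (_+ eps σ i) (sym (*-distribˡ-+ 2 q (des σ i))))

-- From a signed permutation and a partition to the monomial

2μ+fB-adjacent : ∀ (σ : SignedPerm n) {μ} → WeaklyDecreasing μ → ∀ {i j} → i ⋖ j →
                 (2 * μ j + fB σ j ≤ 2 * μ i + fB σ i) ×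
                 (2 * μ i + fB σ i ≡ 2 * μ j + fB σ j → val σ i ℤ.< val σ j)
2μ+fB-adjacent σ {μ} μ↓ {i} {j} i⋖j
  with ℤ.<-cmp (val σ i) (val σ j) | *-monoʳ-≤ 2 (μ↓ i j (<⇒≤ (⋖⇒< i⋖j)))
... | tri< vi<vj _ _ | 2μj≤2μi = +-mono-≤ 2μj≤2μi (fB-ascent σ i⋖j vi<vj) , λ _ → vi<vj
... | tri≈ _ vi≡vj _ | _       = contradiction (val-injective σ vi≡vj) (⋖-irrefl i⋖j)
... | tri> _ _ vj<vi | 2μj≤2μi = <⇒≤ ej<ei , λ ei≡ej → contradiction (sym ei≡ej) (<⇒≢ ej<ei)
  where
  ej<ei : 2 * μ j + fB σ j < 2 * μ i + fB σ i
  ej<ei = +-mono-≤-< 2μj≤2μi (fB-descent σ i⋖j vj<vi)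

2μ+fB⇒IsSignedIndexPerm : ∀ (m : Monomial n) σ {μ} → WeaklyDecreasing μ →
                          (∀ i → 2 * μ i + fB σ i ≡ m (absIx σ i)) → IsSignedIndexPerm m σ
2μ+fB⇒IsSignedIndexPerm m σ {μ} μ↓ m≡ = adjacent , parity
  where
  adjacent : ∀ i j → i ⋖ j →
             (m (absIx σ j) ≤ m (absIx σ i)) × (m (absIx σ i) ≡ m (absIx σ j) → val σ i ℤ.< val σ j)
  adjacent i j i⋖j =
    subst₂ (λ a b → (b ≤ a) × (a ≡ b → val σ i ℤ.< val σ j)) (m≡ i) (m≡ j) (2μ+fB-adjacent σ μ↓ i⋖j)
  parity : ∀ i → val σ i ℤ.> ℤ.+ 0 ⇔ 2 ∣ m (absIx σ i)
  parity i = subst (λ k → val σ i ℤ.> ℤ.+ 0 ⇔ 2 ∣ k) (m≡ i) (eps≡%2⇒parityCondition σ i _ (sym (begin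
    (2 * μ i + fB σ i) % 2               ≡⟨ cong (_% 2) (2*q+fB≡2*[q+des]+eps σ i (μ i)) ⟩
    (2 * (μ i + des σ i) + eps σ i) % 2  ≡⟨ [2*q+r]%2≡r (μ i + des σ i) (s≤s (eps≤1 σ i)) ⟩
    eps σ i                              ∎)))
    where open ≡-Reasoning

position : SignedPerm n → Fin n → Fin n
position σ = proj₁ ∘ injective⇒surjective (proj₂ σ)

absIx∘position : ∀ (σ : SignedPerm n) a → absIx σ (position σ a) ≡ a
absIx∘position σ = proj₂ ∘ injective⇒surjective (proj₂ σ)

position∘absIx : ∀ (σ : SignedPerm n) i → position σ (absIx σ i) ≡ i
position∘absIx σ i = proj₂ σ (absIx∘position σ (absIx σ i))

monomialOf : SignedPerm n → (Fin n → ℕ) → Monomial n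
monomialOf σ μ a = 2 * μ (position σ a) + fB σ (position σ a)

monomialOf-absIx : ∀ (σ : SignedPerm n) μ i → monomialOf σ μ (absIx σ i) ≡ 2 * μ i + fB σ i
monomialOf-absIx σ μ i = cong (λ k → 2 * μ k + fB σ k) (position∘absIx σ i)

Rel-monomialOf : ∀ (σ : SignedPerm n) {μ} → WeaklyDecreasing μ → Rel (monomialOf σ μ) σ μ
Rel-monomialOf σ {μ} μ↓ = 2μ+fB⇒IsSignedIndexPerm (monomialOf σ μ) σ μ↓ m≡ , m≡
  where
  m≡ : ∀ i → 2 * μ i + fB σ i ≡ monomialOf σ μ (absIx σ i)
  m≡ = sym ∘ monomialOf-absIx σ μ

Rel⇒≈monomialOf : ∀ (σ : SignedPerm n) μ {m} → Rel m σ μ → monomialOf σ μ ≈ₘ m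
Rel⇒≈monomialOf σ μ {m} (_ , m≡) a = trans (m≡ (position σ a)) (cong m (absIx∘position σ a))

-- From the monomial to the signed permutation and the partition

-- Exponents decrease and, among equal exponents, signed values increase.
ExponentOrder : StrictTotalOrder 0ℓ 0ℓ 0ℓ
ExponentOrder = ×-strictTotalOrder (Flip.strictTotalOrder ℕ.<-strictTotalOrder) ℤ.<-strictTotalOrder

open StrictTotalOrder ExponentOrder using () renaming (_<_ to _≺_; _≈_ to _≈ₑ_)

≺⇔ : ∀ {k k' : ℕ} {z z' : ℤ} → (k , z) ≺ (k' , z') ⇔ (k' ≤ k × (k ≡ k' → z ℤ.< z'))
≺⇔ {k} {k'} {z} {z'} = mk⇔ to from
  where
  to : (k , z) ≺ (k' , z') → k' ≤ k × (k ≡ k' → z ℤ.< z')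
  to (inj₁ k'<k)          = <⇒≤ k'<k , λ k≡k' → contradiction (sym k≡k') (<⇒≢ k'<k)
  to (inj₂ (k≡k' , z<z')) = ≤-reflexive (sym k≡k') , λ _ → z<z'
  from : k' ≤ k × (k ≡ k' → z ℤ.< z') → (k , z) ≺ (k' , z')
  from (k'≤k , k≡k'⇒z<z') with m≤n⇒m<n∨m≡n k'≤k
  ... | inj₁ k'<k = inj₁ k'<k
  ... | inj₂ k'≡k = inj₂ (sym k'≡k , k≡k'⇒z<z' (sym k'≡k))

signedKey : Monomial n → Fin n → ℕ × ℤ
signedKey p a = p a , signed a (oddBit (p a))

signedKey-injective : ∀ (p : Monomial n) {a b} → signedKey p a ≈ₑ signedKey p b → a ≡ b
signedKey-injective p (_ , signed≡) = signed-injective signed≡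

module SortExponents {n} (p : Monomial n) = SortByKey ExponentOrder (signedKey p) (signedKey-injective p)
open SortExponents using (Sorted; sort; sort-injective; sort-sorted; sorted-unique)

IsSignedIndexPerm⇔ : ∀ (p : Monomial n) σ →
  IsSignedIndexPerm p σ ⇔ (Sorted p (absIx σ) × (∀ i → negBit σ i ≡ oddBit (p (absIx σ i))))
IsSignedIndexPerm⇔ p σ = mk⇔
  (λ (adjacent , parity) → let signs = parity⇒signs parity in
    (λ {i} {j} i⋖j → Equivalence.to (adjacent⇔≺ signs i j) (adjacent i j i⋖j)) , signs)
  (λ (sorted , signs) →
    (λ i j i⋖j → Equivalence.from (adjacent⇔≺ signs i j) (sorted i⋖j)) , signs⇒parity signs)
  where
  Signs : Set
  Signs = ∀ i → negBit σ i ≡ oddBit (p (absIx σ i))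
  Parity : Set
  Parity = ∀ i → val σ i ℤ.> ℤ.+ 0 ⇔ 2 ∣ p (absIx σ i)
  signs⇒parity : Signs → Parity
  signs⇒parity signs i = Equivalence.to (negBit≡oddBit⇔parityCondition σ i _) (signs i)
  parity⇒signs : Parity → Signs
  parity⇒signs parity i = Equivalence.from (negBit≡oddBit⇔parityCondition σ i _) (parity i)
  adjacent⇔≺ : Signs → ∀ i j →
    ((p (absIx σ j) ≤ p (absIx σ i)) × (p (absIx σ i) ≡ p (absIx σ j) → val σ i ℤ.< val σ j))
      ⇔ (signedKey p (absIx σ i) ≺ signedKey p (absIx σ j))
  adjacent⇔≺ signs i j = mk⇔
    (Equivalence.from ≺⇔ ∘ map₂ (subst₂ ℤ._<_ (val≡key i) (val≡key j) ∘_))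
    (map₂ (subst₂ ℤ._<_ (sym (val≡key i)) (sym (val≡key j)) ∘_) ∘ Equivalence.to ≺⇔)
    where
    val≡key : ∀ i → val σ i ≡ proj₂ (signedKey p (absIx σ i))
    val≡key i = trans (val≡signed σ i) (cong (signed (absIx σ i)) (signs i))

signedIndexPerm : (p : Monomial n) → Σ (SignedPerm n) (IsSignedIndexPerm p)
signedIndexPerm p = ((λ i → sort p i , oddBit (p (sort p i))) , sort-injective p) ,
                    Equivalence.from (IsSignedIndexPerm⇔ p _) (sort-sorted p , λ _ → refl)

signedIndexPerm-unique : ∀ (p : Monomial n) {σ τ} → IsSignedIndexPerm p σ → IsSignedIndexPerm p τ → σ ≈ₛ τ
signedIndexPerm-unique p {σ} {τ} Hσ Hτ i = cong₂ _,_ absIx≡ (begin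
  negBit σ i             ≡⟨ signs σ Hσ i ⟩
  oddBit (p (absIx σ i)) ≡⟨ cong (oddBit ∘ p) absIx≡ ⟩
  oddBit (p (absIx τ i)) ≡⟨ signs τ Hτ i ⟨
  negBit τ i             ∎)
  where
  open ≡-Reasoning
  signs : ∀ ρ → IsSignedIndexPerm p ρ → ∀ i → negBit ρ i ≡ oddBit (p (absIx ρ i))
  signs ρ = proj₂ ∘ Equivalence.to (IsSignedIndexPerm⇔ p ρ)
  absIx≡sort : ∀ ρ → IsSignedIndexPerm p ρ → absIx ρ i ≡ sort p i
  absIx≡sort ρ H = sorted-unique p (proj₁ (Equivalence.to (IsSignedIndexPerm⇔ p ρ) H)) i
  absIx≡ : absIx σ i ≡ absIx τ i
  absIx≡ = trans (absIx≡sort σ Hσ) (sym (absIx≡sort τ Hτ))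

module _ (p : Monomial n) (σ : SignedPerm n) (H : IsSignedIndexPerm p σ) where

  half : Fin n → ℕ
  half i = p (absIx σ i) / 2

  exponent≡2*half+eps : ∀ i → p (absIx σ i) ≡ 2 * half i + eps σ i
  exponent≡2*half+eps i =
    trans (m≡2*[m/2]+m%2 _) (cong (2 * half i +_) (sym (parityCondition⇒eps≡%2 σ i _ (proj₂ H i))))

  half-step : ∀ {i j} → i ⋖ j → ∃ λ c → des σ i ≡ c + des σ j × c + half j ≤ half i
  half-step {i} {j} i⋖j with ℤ.<-cmp (val σ i) (val σ j) | proj₁ H i j i⋖j
  ... | tri< vi<vj _ _ | pj≤pi , _ = 0 , des-ascent σ i⋖j vi<vj , /-monoˡ-≤ 2 pj≤pi
  ... | tri≈ _ vi≡vj _ | _         = contradiction (val-injective σ vi≡vj) (⋖-irrefl i⋖j)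
  ... | tri> _ _ vj<vi | pj≤pi , pi≡pj⇒vi<vj = 1 , des-descent σ i⋖j vj<vi ,
    2*m+a<2*n+b⇒m<n (subst₂ _<_ (exponent≡2*half+eps j) (exponent≡2*half+eps i) pj<pi)
                    (eps-antitone σ vj<vi)
    where
    pj<pi : p (absIx σ j) < p (absIx σ i)
    pj<pi = ≤∧≢⇒< pj≤pi λ pj≡pi → ℤ.<-asym vj<vi (pi≡pj⇒vi<vj (sym pj≡pi))

  des≤half : ∀ i → des σ i ≤ half i
  des≤half = ⋖-downwardInduction _ (λ i i-last → subst (_≤ half i) (sym (des-last σ i i-last)) z≤n)
    λ {i} i⋖j dj≤hj → let c , di≡ , c+hj≤hi = half-step i⋖j in
      subst (_≤ half i) (sym di≡) (≤-trans (+-monoʳ-≤ c dj≤hj) c+hj≤hi)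

  half∸des-weaklyDecreasing : WeaklyDecreasing (λ i → half i ∸ des σ i)
  half∸des-weaklyDecreasing = ⋖-weaklyDecreasing λ {i} {j} i⋖j →
    let c , di≡ , c+hj≤hi = half-step i⋖j in begin
      half j ∸ des σ j             ≡⟨ [m+n]∸[m+o]≡n∸o c (half j) (des σ j) ⟨
      (c + half j) ∸ (c + des σ j) ≤⟨ ∸-monoˡ-≤ (c + des σ j) c+hj≤hi ⟩
      half i ∸ (c + des σ j)       ≡⟨ cong (half i ∸_) di≡ ⟨
      half i ∸ des σ i             ∎
    where open ℕ.≤-Reasoning

  partitionOf : Σ (Partition n) (λ μ → Rel p σ (proj₁ μ))
  partitionOf = ((λ i → half i ∸ des σ i) , half∸des-weaklyDecreasing) , H , λ i → begin
    2 * (half i ∸ des σ i) + fB σ i            ≡⟨ 2*q+fB≡2*[q+des]+eps σ i (half i ∸ des σ i) ⟩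
    2 * (half i ∸ des σ i + des σ i) + eps σ i ≡⟨ cong (λ h → 2 * h + eps σ i) (m∸n+n≡m (des≤half i)) ⟩
    2 * half i + eps σ i                       ≡⟨ exponent≡2*half+eps i ⟨
    p (absIx σ i)                              ∎
    where open ≡-Reasoning

Rel-unique : ∀ (p : Monomial n) σ τ {μ ν} → Rel p σ μ → Rel p τ ν → σ ≈ₛ τ → ∀ i → μ i ≡ ν i
Rel-unique p σ τ {μ} {ν} (_ , μ≡) (_ , ν≡) σ≈τ i =
  *-cancelˡ-≡ (μ i) (ν i) 2 (+-cancelʳ-≡ (fB σ i) _ _ (begin
    2 * μ i + fB σ i ≡⟨ μ≡ i ⟩
    p (absIx σ i)    ≡⟨ cong (p ∘ proj₁) (σ≈τ i) ⟩
    p (absIx τ i)    ≡⟨ ν≡ i ⟨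
    2 * ν i + fB τ i ≡⟨ cong (2 * ν i +_) (fB-cong {σ = τ} {σ} (sym ∘ σ≈τ) i) ⟩
    2 * ν i + fB σ i ∎))
  where open ≡-Reasoning

lemma6p6 : (n : ℕ) →
    ((m : Monomial n) →
       Σ (SignedPerm n × Partition n) (λ sμ →
         Rel m (proj₁ sμ) (proj₁ (proj₂ sμ))
         × ((σ : SignedPerm n) (μ : Partition n) → Rel m σ (proj₁ μ) →
              (proj₁ sμ ≈ₛ σ) × (proj₂ sμ ≈ₚ μ))))
    × ((σ : SignedPerm n) (μ : Partition n) →
       Σ (Monomial n) (λ m →
         Rel m σ (proj₁ μ)
         × ((m' : Monomial n) → Rel m' σ (proj₁ μ) → m ≈ₘ m')))
lemma6p6 n =
  (λ m → let σ , H = signedIndexPerm m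
             μ , R = partitionOf m σ H
         in (σ , μ) , R , λ σ' μ' R' →
              let σ≈σ' = signedIndexPerm-unique m H (proj₁ R')
              in σ≈σ' , Rel-unique m σ σ' R R' σ≈σ') ,
  (λ σ (μ , μ↓) → monomialOf σ μ , Rel-monomialOf σ μ↓ , λ _ → Rel⇒≈monomialOf σ μ)
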